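{- Let $p$ be a prime, $m\ge1$, $\sigma:\mathcal A_m\to\mathcal A_m^*$ a $p$-uniform morphism, $t\ge1$ an integer, $r=p^t$ and $\alpha\in\mathbb{F}_r$. Then for every positive integer $k$, $$M_{\sigma^{kt}}(\alpha)=\big(M_{\sigma^t}(\alpha)\big)^k.$$
   Context: $\mathcal A_m=\{0,\dots,m-1\}$. For a word $W=w_0\cdots w_{r'-1}$ over $\mathcal A_m$ and $j\in\mathcal A_m$, $\beta_{W,j}(T)=\sum_{l:\,w_{r'-1-l}=j}T^l\in\mathbb{F}_p[T]$ ($0$ if $j$ does not occur). For a uniform morphism $\tau$ on $\mathcal A_m$, $M_\tau(T)$ is the $m\times m$ matrix over $\mathbb{F}_p[T]$ with $(i,j)$ entry $\beta_{\tau(i),j}(T)$, and $M_\tau(\alpha)$ is its evaluation at $T=\alpha$. -}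

module Defs where

open import Level using (Level; _⊔_)
open import Algebra.Bundles using (CommutativeRing)
open import Data.Nat using (ℕ; zero; suc)
open import Data.Fin using (Fin; _≟_)
import Data.Fin as Fin
open import Data.List using (List; []; _∷_; [_]; length; concatMap; reverse)
open import Data.Product using (Σ)
open import Function.Bundles using (Bijection)
open import Relation.Binary.PropositionalEquality using (_≡_)
import Relation.Binary.PropositionalEquality as ≡
open import Relation.Nullary using (¬_; yes; no)

Word : ℕ → Set
Word m = List (Fin m)

Morphism : ℕ → Set
Morphism m = Fin m → Word m

IsUniform : ∀ {m} → ℕ → Morphism m → Set
IsUniform n σ = ∀ i → length (σ i) ≡ n

extend : ∀ {m} → Morphism m → Word m → Word m
extend σ w = concatMap σ w

iter : ∀ {m} → Morphism m → ℕ → Morphism m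
iter σ zero i = [ i ]
iter σ (suc n) i = extend σ (iter σ n i)

record IsFieldOfOrder {c ℓ} (F : CommutativeRing c ℓ) (r : ℕ) : Set (c ⊔ ℓ) where
  open CommutativeRing F
  field
    1≉0     : ¬ (1# ≈ 0#)
    inverse : ∀ x → ¬ (x ≈ 0#) → Σ Carrier (λ y → x * y ≈ 1#)
    card    : Bijection (≡.setoid (Fin r)) setoid

module _ {c ℓ} (F : CommutativeRing c ℓ) where
  open CommutativeRing F

  pow : Carrier → ℕ → Carrier
  pow x zero = 1#
  pow x (suc n) = x * pow x n

  betaGo : ∀ {m} → Fin m → Carrier → ℕ → Word m → Carrier
  betaGo j α l [] = 0#
  betaGo j α l (x ∷ xs) with x ≟ j
  ... | yes _ = pow α l + betaGo j α (suc l) xs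
  ... | no _  = betaGo j α (suc l) xs

  -- β_{W,j}(α) = Σ_{l : w_{r'-1-l} = j} α^l  (the polynomial β_{W,j}(T) ∈ F_p[T],
  -- which has 0/1 coefficients, evaluated at T = α).
  betaEval : ∀ {m} → Word m → Fin m → Carrier → Carrier
  betaEval W j α = betaGo j α 0 (reverse W)

  Matrix : ℕ → Set c
  Matrix m = Fin m → Fin m → Carrier

  Mat : ∀ {m} → Morphism m → Carrier → Matrix m
  Mat τ α i j = betaEval (τ i) j α

  sumFin : ∀ n → (Fin n → Carrier) → Carrier
  sumFin zero f = 0#
  sumFin (suc n) f = f Fin.zero + sumFin n (λ k → f (Fin.suc k))

  matMul : ∀ {m} → Matrix m → Matrix m → Matrix m
  matMul {m} A B i j = sumFin m (λ k → A i k * B k j)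

  matId : ∀ {m} → Matrix m
  matId i j with i ≟ j
  ... | yes _ = 1#
  ... | no _  = 0#

  matPow : ∀ {m} → Matrix m → ℕ → Matrix m
  matPow A zero = matId
  matPow A (suc k) = matMul A (matPow A k)

-- Reading τ(W) backwards block by block shows that for a q-uniform τ
--   β_{τ(W),j}(T) = Σ_k β_{W,k}(T^q) β_{τ(k),j}(T).
-- As σ^{(k+1)t} = σ^{kt} ∘ σ^t with σ^{kt} p^{kt}-uniform, this gives
--   M_{σ^{(k+1)t}}(α) = M_{σ^t}(α^{p^{kt}}) M_{σ^{kt}}(α),
-- and α^{p^{kt}} = α since every element of F_r satisfies α^r = α (Fermat: multiplication by
-- x ≠ 0 permutes the nonzero elements, so comparing their products gives x^{r-1} = 1).

module Submission where

open import Defs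
open import Algebra.Bundles using (CommutativeRing; CommutativeMonoid)
open import Data.Nat as ℕ using (ℕ; zero; suc; _^_)
import Data.Nat.Properties as ℕ
open import Data.Nat.Primality using (Prime)
open import Data.Fin as Fin using (Fin; punchIn)
open import Data.Fin.Properties using (punchInᵢ≢i)
open import Data.Fin.Permutation using (Permutation; permutation)
open import Data.List using ([]; _∷_; [_]; length; reverse; _++_)
import Data.List.Properties as List
open import Data.List.Effectful using (module MonadProperties)
open import Data.Product using (_,_)
open import Function.Base using (_∘_)
open import Function.Bundles using (Inverse)
open import Function.Properties.Bijection using (Bijection⇒Inverse)
open import Relation.Binary.Definitions using (Decidable)
open import Relation.Binary.PropositionalEquality as ≡ using (_≡_; _≢_)
open import Relation.Nullary using (¬_; yes; no; contradiction)

iter-+ : ∀ {m} (σ : Morphism m) n a i → iter σ (n ℕ.+ a) i ≡ extend (iter σ n) (iter σ a i)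
iter-+ σ zero    a i = ≡.sym (List.concatMap-pure (iter σ a i))
iter-+ σ (suc n) a i = ≡.trans (≡.cong (extend σ) (iter-+ σ n a i))
                               (≡.sym (MonadProperties.associative (iter σ a i) (iter σ n) σ))

length-extend : ∀ {m} q (τ : Morphism m) → IsUniform q τ → ∀ w → length (extend τ w) ≡ length w ℕ.* q
length-extend q τ τ-uniform []      = ≡.refl
length-extend q τ τ-uniform (a ∷ w) = ≡.trans (List.length-++ (τ a))
  (≡.cong₂ ℕ._+_ (τ-uniform a) (length-extend q τ τ-uniform w))

iter-uniform : ∀ {m} p (σ : Morphism m) → IsUniform p σ → ∀ n → IsUniform (p ^ n) (iter σ n)
iter-uniform p σ σ-uniform zero    i = ≡.refl
iter-uniform p σ σ-uniform (suc n) i = ≡.trans (length-extend p σ σ-uniform (iter σ n i))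
  (≡.trans (≡.cong (ℕ._* p) (iter-uniform p σ σ-uniform n i)) (ℕ.*-comm (p ^ n) p))

module _ {a ℓ} (M : CommutativeMonoid a ℓ) where
  open CommutativeMonoid M
  open import Algebra.Properties.CommutativeMonoid.Sum M
    using (sum; sum-remove; sum-cong-≋; sum-replicate-zero)

  sum-concentrated : ∀ {n} (f : Fin n → Carrier) i → (∀ k → k ≢ i → f k ≈ ε) → sum f ≈ f i
  sum-concentrated {suc n} f i f≈ε = trans (sum-remove {i = i} f) (trans
    (∙-congˡ (trans (sum-cong-≋ (λ k → f≈ε (punchIn i k) (punchInᵢ≢i i k))) (sum-replicate-zero n)))
    (identityʳ (f i)))

module _ {c ℓ} (F : CommutativeRing c ℓ) where
  open CommutativeRing F
  open import Algebra.Properties.Semiring.Sum semiring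
    using (sum; sum-cong-≋; ∑-distrib-+; *-distribˡ-sum)
  open import Relation.Binary.Reasoning.Setoid setoid

  pow-cong : ∀ {x y} n → x ≈ y → pow F x n ≈ pow F y n
  pow-cong zero    x≈y = refl
  pow-cong (suc n) x≈y = *-cong x≈y (pow-cong n x≈y)

  pow-+ : ∀ x a b → pow F x (a ℕ.+ b) ≈ pow F x a * pow F x b
  pow-+ x zero    b = sym (*-identityˡ _)
  pow-+ x (suc a) b = trans (*-congˡ (pow-+ x a b)) (sym (*-assoc _ _ _))

  pow-* : ∀ x a b → pow F x (a ℕ.* b) ≈ pow F (pow F x b) a
  pow-* x zero    b = refl
  pow-* x (suc a) b = trans (pow-+ x b (a ℕ.* b)) (*-congˡ (pow-* x a b))

  pow-^-fixed : ∀ {α} q → pow F α q ≈ α → ∀ k → pow F α (q ^ k) ≈ α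
  pow-^-fixed q α^q≈α zero    = *-identityʳ _
  pow-^-fixed q α^q≈α (suc k) =
    trans (pow-* _ q (q ^ k)) (trans (pow-cong q (pow-^-fixed q α^q≈α k)) α^q≈α)

  matId-diagonal : ∀ {m} (i : Fin m) → matId F i i ≈ 1#
  matId-diagonal i with i Fin.≟ i
  ... | yes _  = refl
  ... | no i≢i = contradiction ≡.refl i≢i

  matId-offDiagonal : ∀ {m} {i j : Fin m} → i ≢ j → matId F i j ≈ 0#
  matId-offDiagonal {i = i} {j} i≢j with i Fin.≟ j
  ... | yes i≡j = contradiction i≡j i≢j
  ... | no _    = refl

  sum-matId : ∀ {m} i (f : Fin m → Carrier) → sum (λ k → matId F i k * f k) ≈ f i
  sum-matId i f = trans
    (sum-concentrated +-commutativeMonoid _ i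
      (λ k k≢i → trans (*-congʳ (matId-offDiagonal (k≢i ∘ ≡.sym))) (zeroˡ (f k))))
    (trans (*-congʳ (matId-diagonal i)) (*-identityˡ (f i)))

  sumFin≡sum : ∀ n (f : Fin n → Carrier) → sumFin F n f ≡ sum f
  sumFin≡sum zero    f = ≡.refl
  sumFin≡sum (suc n) f = ≡.cong (f Fin.zero +_) (sumFin≡sum n (f ∘ Fin.suc))

  betaGo-suc : ∀ {m} (j : Fin m) α l xs → betaGo F j α (suc l) xs ≈ α * betaGo F j α l xs
  betaGo-suc j α l []       = sym (zeroʳ α)
  betaGo-suc j α l (x ∷ xs) with x Fin.≟ j
  ... | yes _ = trans (+-congˡ (betaGo-suc j α (suc l) xs)) (sym (distribˡ _ _ _))
  ... | no _  = betaGo-suc j α (suc l) xs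

  betaGo-cong : ∀ {m} (j : Fin m) {α β} l xs → α ≈ β → betaGo F j α l xs ≈ betaGo F j β l xs
  betaGo-cong j l []       α≈β = refl
  betaGo-cong j l (x ∷ xs) α≈β with x Fin.≟ j
  ... | yes _ = +-cong (pow-cong l α≈β) (betaGo-cong j (suc l) xs α≈β)
  ... | no _  = betaGo-cong j (suc l) xs α≈β

  betaGo-∷ : ∀ {m} (j : Fin m) α l x xs →
             betaGo F j α l (x ∷ xs) ≈ betaGo F j α l [ x ] + betaGo F j α (suc l) xs
  betaGo-∷ j α l x xs with x Fin.≟ j
  ... | yes _ = +-congʳ (sym (+-identityʳ _))
  ... | no _  = sym (+-identityˡ _)

  betaGo-++ : ∀ {m} (j : Fin m) α l xs ys →
              betaGo F j α l (xs ++ ys) ≈ betaGo F j α l xs + pow F α (length xs) * betaGo F j α l ys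
  betaGo-++ j α l []       ys = sym (trans (+-identityˡ _) (*-identityˡ _))
  betaGo-++ j α l (x ∷ xs) ys = begin
    βl (x ∷ xs ++ ys)
      ≈⟨ betaGo-∷ j α l x (xs ++ ys) ⟩
    βl [ x ] + βsl (xs ++ ys)
      ≈⟨ +-congˡ (betaGo-++ j α (suc l) xs ys) ⟩
    βl [ x ] + (βsl xs + pow F α (length xs) * βsl ys)
      ≈⟨ +-congˡ (+-congˡ (*-congˡ (betaGo-suc j α l ys))) ⟩
    βl [ x ] + (βsl xs + pow F α (length xs) * (α * βl ys))
      ≈⟨ +-congˡ (+-congˡ (trans (sym (*-assoc _ _ _)) (*-congʳ (*-comm _ α)))) ⟩
    βl [ x ] + (βsl xs + pow F α (suc (length xs)) * βl ys)
      ≈⟨ sym (+-assoc _ _ _) ⟩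
    (βl [ x ] + βsl xs) + pow F α (suc (length xs)) * βl ys
      ≈⟨ +-congʳ (sym (betaGo-∷ j α l x xs)) ⟩
    βl (x ∷ xs) + pow F α (suc (length xs)) * βl ys ∎
    where
    βl βsl : Word _ → Carrier
    βl  = betaGo F j α l
    βsl = betaGo F j α (suc l)

  betaEval-cong : ∀ {m} (W : Word m) j {α β} → α ≈ β → betaEval F W j α ≈ betaEval F W j β
  betaEval-cong W j = betaGo-cong j 0 (reverse W)

  betaEval-++ : ∀ {m} (U V : Word m) j α →
                betaEval F (U ++ V) j α ≈ betaEval F V j α + pow F α (length V) * betaEval F U j α
  betaEval-++ U V j α = begin
    betaGo F j α 0 (reverse (U ++ V))
      ≡⟨ ≡.cong (betaGo F j α 0) (List.reverse-++ U V) ⟩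
    betaGo F j α 0 (reverse V ++ reverse U)
      ≈⟨ betaGo-++ j α 0 (reverse V) (reverse U) ⟩
    betaEval F V j α + pow F α (length (reverse V)) * betaEval F U j α
      ≡⟨ ≡.cong (λ n → betaEval F V j α + pow F α n * betaEval F U j α) (List.length-reverse V) ⟩
    betaEval F V j α + pow F α (length V) * betaEval F U j α ∎

  betaEval-[_] : ∀ {m} (i : Fin m) {k α} → betaEval F [ i ] k α ≈ matId F i k
  betaEval-[_] i {k} with i Fin.≟ k
  ... | yes _ = +-identityʳ 1#
  ... | no _  = refl

  betaEval-∷ : ∀ {m} i (W : Word m) k α →
               betaEval F (i ∷ W) k α ≈ betaEval F W k α + pow F α (length W) * matId F i k
  betaEval-∷ i W k α = trans (betaEval-++ [ i ] W k α) (+-congˡ (*-congˡ betaEval-[ i ]))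

  betaEval-extend : ∀ {m} q (τ : Morphism m) → IsUniform q τ → ∀ (W : Word m) j α →
    betaEval F (extend τ W) j α ≈ sum (λ k → betaEval F W k (pow F α q) * betaEval F (τ k) j α)
  betaEval-extend q τ τ-uniform [] j α =
    sym (trans (sym (*-distribˡ-sum 0# (λ k → betaEval F (τ k) j α))) (zeroˡ _))
  betaEval-extend {m} q τ τ-uniform (i ∷ W) j α = begin
    betaEval F (τ i ++ extend τ W) j α
      ≈⟨ betaEval-++ (τ i) (extend τ W) j α ⟩
    betaEval F (extend τ W) j α + pow F α (length (extend τ W)) * N i
      ≈⟨ +-cong (betaEval-extend q τ τ-uniform W j α) (*-congʳ (trans
           (reflexive (≡.cong (pow F α) (length-extend q τ τ-uniform W))) (pow-* α (length W) q))) ⟩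
    sum (λ k → B W k * N k) + pow F β (length W) * N i
      ≈⟨ +-congˡ (*-congˡ (sym (sum-matId i N))) ⟩
    sum (λ k → B W k * N k) + pow F β (length W) * sum (λ k → matId F i k * N k)
      ≈⟨ +-congˡ (*-distribˡ-sum (pow F β (length W)) (λ k → matId F i k * N k)) ⟩
    sum (λ k → B W k * N k) + sum (λ k → pow F β (length W) * (matId F i k * N k))
      ≈⟨ sym (∑-distrib-+ (λ k → B W k * N k) _) ⟩
    sum (λ k → B W k * N k + pow F β (length W) * (matId F i k * N k))
      ≈⟨ sum-cong-≋ {m} (λ k → trans (+-congˡ (sym (*-assoc _ _ _))) (sym (distribʳ _ _ _))) ⟩
    sum (λ k → (B W k + pow F β (length W) * matId F i k) * N k)
      ≈⟨ sum-cong-≋ {m} (λ k → *-congʳ (sym (betaEval-∷ i W k β))) ⟩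
    sum (λ k → B (i ∷ W) k * N k) ∎
    where
    β : Carrier
    β = pow F α q
    B : Word m → Fin m → Carrier
    B W k = betaEval F W k β
    N : Fin m → Carrier
    N k = betaEval F (τ k) j α

  Mat-iter-* : ∀ {m} p (σ : Morphism m) → IsUniform p σ → ∀ t α → pow F α (p ^ t) ≈ α →
               ∀ k i j → Mat F (iter σ (k ℕ.* t)) α i j ≈ matPow F (Mat F (iter σ t) α) k i j
  Mat-iter-* p σ σ-uniform t α α-fixed zero    i j = betaEval-[ i ]
  Mat-iter-* {m} p σ σ-uniform t α α-fixed (suc k) i j = begin
    betaEval F (iter σ (t ℕ.+ kt) i) j α
      ≡⟨ ≡.cong (λ w → betaEval F w j α)
           (≡.trans (≡.cong (λ n → iter σ n i) (ℕ.+-comm t kt)) (iter-+ σ kt t i)) ⟩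
    betaEval F (extend (iter σ kt) (iter σ t i)) j α
      ≈⟨ betaEval-extend (p ^ kt) (iter σ kt) (iter-uniform p σ σ-uniform kt) (iter σ t i) j α ⟩
    sum (λ l → betaEval F (iter σ t i) l (pow F α (p ^ kt)) * Mat F (iter σ kt) α l j)
      ≈⟨ sum-cong-≋ {m} (λ l → *-cong (betaEval-cong (iter σ t i) l α^p^kt≈α)
                                       (Mat-iter-* p σ σ-uniform t α α-fixed k l j)) ⟩
    sum (λ l → A i l * matPow F A k l j)
      ≡⟨ ≡.sym (sumFin≡sum m _) ⟩
    matPow F A (suc k) i j ∎
    where
    kt : ℕ
    kt = k ℕ.* t
    A : Matrix F m
    A = Mat F (iter σ t) α
    α^p^kt≈α : pow F α (p ^ kt) ≈ α
    α^p^kt≈α = trans (reflexive (≡.cong (pow F α)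
                 (≡.trans (≡.cong (p ^_) (ℕ.*-comm k t)) (≡.sym (ℕ.^-*-assoc p t k)))))
               (pow-^-fixed (p ^ t) α-fixed k)

module FiniteField {c ℓ} (F : CommutativeRing c ℓ) {r : ℕ} (isF : IsFieldOfOrder F r) where
  open CommutativeRing F
  open IsFieldOfOrder isF
  open Inverse (Bijection⇒Inverse card)
    using (to; from; to-cong; from-cong; strictlyInverseˡ; strictlyInverseʳ)
  open import Algebra.Properties.CommutativeMonoid.Sum *-commutativeMonoid
    using (sum-cong-≋; sum-permute; ∑-distrib-+) renaming (sum to product)
  open import Relation.Binary.Reasoning.Setoid setoid

  _≈?_ : Decidable _≈_
  x ≈? y with from x Fin.≟ from y
  ... | yes fx≡fy = yes (trans (sym (strictlyInverseˡ x)) (trans (to-cong fx≡fy) (strictlyInverseˡ y)))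
  ... | no fx≢fy  = no (fx≢fy ∘ from-cong)

  inverse-cancel : ∀ {a b} → a * b ≈ 1# → ∀ y → a * (b * y) ≈ y
  inverse-cancel {a} {b} ab≈1 y = trans (sym (*-assoc a b y)) (trans (*-congʳ ab≈1) (*-identityˡ y))

  *-cancelˡ : ∀ {a x y} → ¬ a ≈ 0# → a * x ≈ a * y → x ≈ y
  *-cancelˡ {a} {x} {y} a≉0 ax≈ay with inverse a a≉0
  ... | a⁻¹ , aa⁻¹≈1 = begin
    x              ≈⟨ sym (inverse-cancel a⁻¹a≈1 x) ⟩
    a⁻¹ * (a * x)  ≈⟨ *-congˡ ax≈ay ⟩
    a⁻¹ * (a * y)  ≈⟨ inverse-cancel a⁻¹a≈1 y ⟩
    y              ∎
    where
    a⁻¹a≈1 : a⁻¹ * a ≈ 1#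
    a⁻¹a≈1 = trans (*-comm a⁻¹ a) aa⁻¹≈1

  *-nonzero : ∀ {a b} → ¬ a ≈ 0# → ¬ b ≈ 0# → ¬ a * b ≈ 0#
  *-nonzero {a} a≉0 b≉0 ab≈0 = b≉0 (*-cancelˡ a≉0 (trans ab≈0 (sym (zeroʳ a))))

  product-nonzero : ∀ {n} (f : Fin n → Carrier) → (∀ i → ¬ f i ≈ 0#) → ¬ product f ≈ 0#
  product-nonzero {zero}  f f≉0 = 1≉0
  product-nonzero {suc n} f f≉0 =
    *-nonzero (f≉0 Fin.zero) (product-nonzero (f ∘ Fin.suc) (f≉0 ∘ Fin.suc))

  product-const : ∀ x n → product {n} (λ _ → x) ≈ pow F x n
  product-const x zero    = refl
  product-const x (suc n) = *-congˡ (product-const x n)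

  ∏ : (Carrier → Carrier) → Carrier
  ∏ g = product (g ∘ to)

  scaling : ∀ {x y} → x * y ≈ 1# → Permutation r r
  scaling {x} {y} xy≈1 = permutation (λ i → from (x * to i)) (λ i → from (y * to i))
    (undo xy≈1) (undo (trans (*-comm y x) xy≈1))
    where
    undo : ∀ {a b} → a * b ≈ 1# → ∀ i → from (a * to (from (b * to i))) ≡ i
    undo ab≈1 i = ≡.trans (from-cong (trans (*-congˡ (strictlyInverseˡ _)) (inverse-cancel ab≈1 (to i))))
                          (strictlyInverseʳ i)

  ∏-scaling : ∀ {x y} → x * y ≈ 1# → ∀ (g : Carrier → Carrier) → (∀ {u v} → u ≈ v → g u ≈ g v) →
              ∏ (λ u → g (x * u)) ≈ ∏ g
  ∏-scaling {x} xy≈1 g g-cong = sym (trans (sum-permute (g ∘ to) (scaling xy≈1))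
    (sum-cong-≋ {r} (λ i → g-cong (strictlyInverseˡ (x * to i)))))

  ifZero : Carrier → Carrier → Carrier → Carrier
  ifZero y a b with y ≈? 0#
  ... | yes _ = a
  ... | no _  = b

  ifZero-elim : ∀ {p} (P : Carrier → Set p) y a b → (y ≈ 0# → P a) → (¬ y ≈ 0# → P b) → P (ifZero y a b)
  ifZero-elim P y a b Pa Pb with y ≈? 0#
  ... | yes y≈0 = Pa y≈0
  ... | no y≉0  = Pb y≉0

  ifZero-yes : ∀ {y} a b → y ≈ 0# → ifZero y a b ≈ a
  ifZero-yes {y} a b y≈0 = ifZero-elim (_≈ a) y a b (λ _ → refl) (contradiction y≈0)

  ifZero-no : ∀ {y} a b → ¬ y ≈ 0# → ifZero y a b ≈ b
  ifZero-no {y} a b y≉0 = ifZero-elim (_≈ b) y a b (λ y≈0 → contradiction y≈0 y≉0) (λ _ → refl)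

  zeroToOne : Carrier → Carrier
  zeroToOne y = ifZero y 1# y

  zeroToOne-nonzero : ∀ y → ¬ zeroToOne y ≈ 0#
  zeroToOne-nonzero y = ifZero-elim (λ z → ¬ z ≈ 0#) y 1# y (λ _ → 1≉0) (λ y≉0 → y≉0)

  zeroToOne-cong : ∀ {u v} → u ≈ v → zeroToOne u ≈ zeroToOne v
  zeroToOne-cong {u} {v} u≈v = ifZero-elim (_≈ zeroToOne v) u 1# u
    (λ u≈0 → sym (ifZero-yes 1# v (trans (sym u≈v) u≈0)))
    (λ u≉0 → trans u≈v (sym (ifZero-no 1# v (u≉0 ∘ trans u≈v))))

  ∏-ifZero : ∀ a → ∏ (λ y → ifZero y a 1#) ≈ a
  ∏-ifZero a = trans
    (sum-concentrated *-commutativeMonoid _ (from 0#)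
      (λ k k≢z → ifZero-no a 1#
        (λ to-k≈0 → k≢z (≡.trans (≡.sym (strictlyInverseʳ k)) (from-cong to-k≈0)))))
    (ifZero-yes a 1# (strictlyInverseˡ 0#))

  zeroToOne-* : ∀ {x} → ¬ x ≈ 0# → ∀ y → ifZero y x 1# * zeroToOne (x * y) ≈ x * zeroToOne y
  zeroToOne-* {x} x≉0 y = ifZero-elim (λ e → e * zeroToOne (x * y) ≈ x * zeroToOne y) y x 1#
    (λ y≈0 → *-congˡ (trans (ifZero-yes 1# (x * y) (trans (*-congˡ y≈0) (zeroʳ x)))
                            (sym (ifZero-yes 1# y y≈0))))
    (λ y≉0 → trans (*-identityˡ _) (trans (ifZero-no 1# (x * y) (*-nonzero x≉0 y≉0))
                                          (*-congˡ (sym (ifZero-no 1# y y≉0)))))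

  -- ∏ zeroToOne is the product of the nonzero elements; ifZero y x 1# restores the factor x
  -- that scaling does not contribute at y = 0.
  ∏-zeroToOne-* : ∀ {x} → ¬ x ≈ 0# → x * ∏ zeroToOne ≈ pow F x r * ∏ zeroToOne
  ∏-zeroToOne-* {x} x≉0 with inverse x x≉0
  ... | _ , xx⁻¹≈1 = begin
    x * ∏ zeroToOne
      ≈⟨ *-cong (sym (∏-ifZero x)) (sym (∏-scaling xx⁻¹≈1 zeroToOne zeroToOne-cong)) ⟩
    ∏ (λ y → ifZero y x 1#) * ∏ (λ y → zeroToOne (x * y))
      ≈⟨ sym (∑-distrib-+ (λ i → ifZero (to i) x 1#) _) ⟩
    ∏ (λ y → ifZero y x 1# * zeroToOne (x * y))
      ≈⟨ sum-cong-≋ {r} (zeroToOne-* x≉0 ∘ to) ⟩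
    ∏ (λ y → x * zeroToOne y)
      ≈⟨ ∑-distrib-+ (λ _ → x) (zeroToOne ∘ to) ⟩
    product {r} (λ _ → x) * ∏ zeroToOne
      ≈⟨ *-congʳ (product-const x r) ⟩
    pow F x r * ∏ zeroToOne ∎

  frobenius : ∀ x → pow F x r ≈ x
  frobenius x with x ≈? 0#
  ... | yes x≈0 = trans (pow-cong F r x≈0) (trans (zero-pow (from 0#)) (sym x≈0))
    where
    zero-pow : ∀ {n} → Fin n → pow F 0# n ≈ 0#
    zero-pow {suc n} _ = zeroˡ _
  ... | no x≉0  = sym (*-cancelˡ (product-nonzero (zeroToOne ∘ to) (zeroToOne-nonzero ∘ to))
    (trans (*-comm _ x) (trans (∏-zeroToOne-* x≉0) (*-comm _ _))))

open import Data.Nat using (_*_; _≤_)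

proposition4p14 : ∀ {c ℓ} (p : ℕ) → Prime p → (m : ℕ) → 1 ≤ m →
    (σ : Morphism m) → IsUniform p σ → (t : ℕ) → 1 ≤ t →
    (F : CommutativeRing c ℓ) → IsFieldOfOrder F (p ^ t) →
    (α : CommutativeRing.Carrier F) → (k : ℕ) → 1 ≤ k →
    ∀ i j → CommutativeRing._≈_ F (Mat F (iter σ (k * t)) α i j)
                                  (matPow F (Mat F (iter σ t) α) k i j)
proposition4p14 p _ m _ σ σ-uniform t _ F isF α k _ =
  Mat-iter-* F p σ σ-uniform t α (FiniteField.frobenius F isF α) k
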